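{- Let $G$ be a group with identity $e$ and let $A$ be a symmetric generating set for $G$ with $e\in A$. Suppose that for every $x\in G$ there exists $a\in A$ with $\ell_A(ax)=1+\ell_A(x)$. Then for every nonnegative integer $h$, the set \[ C=\bigcup_{q=0}^{\infty} S_e((2h+1)q) \] is an $h$-net in the metric space $(G,d_A)$.
   Context: A subset $A$ of $G$ is symmetric if $a\in A$ iff $a^{ -1}\in A$. The word length $\ell_A(x)$ is $0$ if $x=e$ and otherwise the least $r\ge1$ with $x=a_1\cdots a_r$, $a_i\in A$. The metric is $d_A(x,y)=\ell_A(xy^{ -1})$. For an integer $m\ge0$, $S_e(m)=\{x\in G:\ell_A(x)=m\}$. An $h$-net in a metric space $(X,d)$ is a subset $C$ such that for every $x\in X$ there is $z\in C$ with $d(x,z)\le h$. -}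

module Defs where

open import Level using (Level; _⊔_)
open import Algebra.Bundles using (Group)
open import Data.Nat using (ℕ; zero; suc; _≤_; _<_; _+_; _*_)
open import Data.List using (List; []; _∷_; length; foldr)
open import Data.List.Relation.Unary.All using (All)
open import Data.Product using (Σ; ∃; _×_; _,_)
open import Data.Sum using (_⊎_)
open import Relation.Binary.PropositionalEquality using (_≡_)
open import Relation.Nullary using (¬_)

module WordMetric {c ℓ a : Level} (G : Group c ℓ) (A : Group.Carrier G → Set a) where
  open Group G

  prod : List Carrier → Carrier
  prod = foldr _∙_ ε

  ProdOf : ℕ → Carrier → Set (c ⊔ ℓ ⊔ a)
  ProdOf r x = Σ (List Carrier) λ w → length w ≡ r × All A w × prod w ≈ x

  -- A respects the setoid equality of G (A is a subset of G)
  RespectsEq : Set (c ⊔ ℓ ⊔ a)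
  RespectsEq = ∀ {x y} → x ≈ y → A x → A y

  Symmetric : Set (c ⊔ a)
  Symmetric = ∀ x → (A x → A (x ⁻¹)) × (A (x ⁻¹) → A x)

  Generating : Set (c ⊔ ℓ ⊔ a)
  Generating = ∀ x → ∃ λ r → ProdOf r x

  WordLength : Carrier → ℕ → Set (c ⊔ ℓ ⊔ a)
  WordLength x m =
    (x ≈ ε × m ≡ 0)
    ⊎ (¬ (x ≈ ε) × 1 ≤ m × ProdOf m x × (∀ r → 1 ≤ r → r < m → ¬ ProdOf r x))

  Dist : Carrier → Carrier → ℕ → Set (c ⊔ ℓ ⊔ a)
  Dist x y m = WordLength (x ∙ y ⁻¹) m

  InC : ℕ → Carrier → Set (c ⊔ ℓ ⊔ a)
  InC h z = ∃ λ q → WordLength z ((2 * h + 1) * q)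

  IsNet : ℕ → (Carrier → Set (c ⊔ ℓ ⊔ a)) → Set (c ⊔ ℓ ⊔ a)
  IsNet h C = ∀ x → ∃ λ z → C z × ∃ λ m → m ≤ h × Dist x z m

module Submission where

-- Put K = 2h + 1 and let x ∈ G have word length n.
-- Write n = Kq + r with 0 ≤ r < K.
--   * If r ≤ h, cut a geodesic word for x after its first r letters:
--     x = p · z where p is a product of r letters and z has length Kq,
--     so z ∈ C and d(x, z) = ℓ(p) ≤ r ≤ h.
--   * If r > h, then k = K - r ≤ h.  The extension hypothesis lets us
--     prolong geodesics: applying it k times yields y = u · x of length
--     n + k = K(q + 1), where u is a product of k letters; so y ∈ C and
--     d(x, y) = ℓ(u⁻¹) ≤ k ≤ h, using that A is symmetric.

open import Defs
open import Level using (Level)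
open import Algebra.Bundles using (Group)
open import Data.Nat using (ℕ; zero; suc; _≤_; _+_; _*_; _∸_; _⊓_; _≤?_; z≤n; s≤s; NonZero; >-nonZero)
open import Data.Nat.Properties
open import Data.Nat.DivMod using (_%_; _/_; m≡m%n+[m/n]*n; m%n<n)
open import Data.Nat.Tactic.RingSolver using (solve-∀)
open import Data.Product using (∃; ∃₂; _×_; _,_; proj₁)
open import Data.Sum using (_⊎_; inj₁; inj₂)
open import Data.List using ([]; _∷_; _++_; [_]; length; take; drop)
open import Data.List.Properties using (length-++; length-take; length-drop; take++drop≡id)
open import Data.List.Relation.Unary.All using (All; []; _∷_)
open import Data.List.Relation.Unary.All.Properties using (++⁺; take⁺; drop⁺)
open import Relation.Binary.PropositionalEquality as ≡ using (_≡_; refl; cong; module ≡-Reasoning)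
open import Relation.Nullary using (yes; no)
open import Data.Empty using (⊥-elim)
import Algebra.Properties.Group as GroupProperties

odd-split : ∀ h → 2 * h + 1 ≡ h + suc h
odd-split = solve-∀

module Division (h n : ℕ) where
  K : ℕ
  K = 2 * h + 1

  instance
    K-nonZero : NonZero K
    K-nonZero = >-nonZero (m≤n+m 1 (2 * h))

  r q : ℕ
  r = n % K
  q = n / K

  n≡r+Kq : n ≡ r + K * q
  n≡r+Kq = ≡.trans (m≡m%n+[m/n]*n n K) (cong (r +_) (*-comm q K))

  r≤K : r ≤ K
  r≤K = <⇒≤ (m%n<n n K)

nearMultiple : ∀ h n →
  (∃₂ λ q r → r ≤ h × n ≡ r + (2 * h + 1) * q) ⊎
  (∃₂ λ q k → k ≤ h × n + k ≡ (2 * h + 1) * q)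
nearMultiple h n with Division.r h n ≤? h
... | yes r≤h = inj₁ (q , r , r≤h , n≡r+Kq)
  where open Division h n
... | no r≰h = inj₂ (suc q , K ∸ r , k≤h , n+k≡K[q+1])
  where
  open Division h n
  k≤h : K ∸ r ≤ h
  k≤h = begin
    K ∸ r              ≤⟨ ∸-monoʳ-≤ K (≰⇒> r≰h) ⟩
    K ∸ suc h          ≡⟨ cong (_∸ suc h) (odd-split h) ⟩
    h + suc h ∸ suc h  ≡⟨ m+n∸n≡m h (suc h) ⟩
    h                  ∎
    where open ≤-Reasoning
  n+k≡K[q+1] : n + (K ∸ r) ≡ K * suc q
  n+k≡K[q+1] = begin
    n + (K ∸ r)            ≡⟨ cong (_+ (K ∸ r)) n≡r+Kq ⟩
    r + K * q + (K ∸ r)    ≡⟨ +-assoc r (K * q) (K ∸ r) ⟩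
    r + (K * q + (K ∸ r))  ≡⟨ cong (r +_) (+-comm (K * q) (K ∸ r)) ⟩
    r + ((K ∸ r) + K * q)  ≡⟨ ≡.sym (+-assoc r (K ∸ r) (K * q)) ⟩
    r + (K ∸ r) + K * q    ≡⟨ cong (_+ K * q) (m+[n∸m]≡n r≤K) ⟩
    K + K * q              ≡⟨ ≡.sym (*-suc K q) ⟩
    K * suc q              ∎
    where open ≡-Reasoning

module WordFacts {c ℓ a : Level} (G : Group c ℓ) (A : Group.Carrier G → Set a) where
  open Group G renaming (refl to ≈-refl)
  open WordMetric G A
  open GroupProperties G using (ε⁻¹≈ε; ⁻¹-anti-homo-∙; \\-leftDividesˡ; //-rightDividesʳ)

  prod-++ : ∀ u v → prod (u ++ v) ≈ prod u ∙ prod v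
  prod-++ []      v = sym (identityˡ (prod v))
  prod-++ (b ∷ u) v = trans (∙-congˡ (prod-++ u v)) (sym (assoc b (prod u) (prod v)))

  ProdOf-resp : ∀ {r x y} → x ≈ y → ProdOf r x → ProdOf r y
  ProdOf-resp x≈y (w , |w| , w∈A , w≈x) = w , |w| , w∈A , trans w≈x x≈y

  ProdOf-∙ : ∀ {r s x y} → ProdOf r x → ProdOf s y → ProdOf (r + s) (x ∙ y)
  ProdOf-∙ (u , refl , u∈A , u≈x) (v , refl , v∈A , v≈y) =
    u ++ v , length-++ u , ++⁺ u∈A v∈A , trans (prod-++ u v) (∙-cong u≈x v≈y)

  ProdOf-letter : ∀ {b} → A b → ProdOf 1 b
  ProdOf-letter {b} b∈A = [ b ] , refl , b∈A ∷ [] , identityʳ b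

  ProdOf-ε : ProdOf 0 ε
  ProdOf-ε = [] , refl , [] , ≈-refl

  ProdOf-split : ∀ r s {x} → ProdOf (r + s) x →
    ∃₂ λ p z → ProdOf r p × ProdOf s z × x ≈ p ∙ z
  ProdOf-split r s (w , |w| , w∈A , w≈x) =
    prod (take r w) , prod (drop r w) ,
    (take r w , |take| , take⁺ r w∈A , ≈-refl) ,
    (drop r w , |drop| , drop⁺ r w∈A , ≈-refl) ,
    trans (sym w≈x) (trans (reflexive (cong prod (≡.sym (take++drop≡id r w))))
                           (prod-++ (take r w) (drop r w)))
    where
    open ≡-Reasoning
    |take| : length (take r w) ≡ r
    |take| = begin
      length (take r w)  ≡⟨ length-take r w ⟩
      r ⊓ length w       ≡⟨ cong (r ⊓_) |w| ⟩
      r ⊓ (r + s)        ≡⟨ m≤n⇒m⊓n≡m (m≤m+n r s) ⟩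
      r                  ∎
    |drop| : length (drop r w) ≡ s
    |drop| = begin
      length (drop r w)  ≡⟨ length-drop r w ⟩
      length w ∸ r       ≡⟨ cong (_∸ r) |w| ⟩
      r + s ∸ r          ≡⟨ m+n∸m≡n r s ⟩
      s                  ∎

  -- For symmetric A, inverting a product of r letters gives another one:
  -- (b₁ ⋯ bᵣ)⁻¹ = bᵣ⁻¹ ⋯ b₁⁻¹.
  ProdOf-⁻¹ : Symmetric → ∀ {r x} → ProdOf r x → ProdOf r (x ⁻¹)
  ProdOf-⁻¹ symA (w , refl , w∈A , w≈x) = ProdOf-resp (⁻¹-cong w≈x) (inverse-word w w∈A)
    where
    inverse-word : ∀ w → All A w → ProdOf (length w) (prod w ⁻¹)
    inverse-word []      []          = ProdOf-resp (sym ε⁻¹≈ε) ProdOf-ε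
    inverse-word (b ∷ w) (b∈A ∷ w∈A) =
      ProdOf-resp (sym (⁻¹-anti-homo-∙ b (prod w)))
        (≡.subst (λ t → ProdOf t (prod w ⁻¹ ∙ b ⁻¹)) (+-comm (length w) 1)
          (ProdOf-∙ (inverse-word w w∈A) (ProdOf-letter (proj₁ (symA b) b∈A))))

  WordLength-minimal : ∀ {x m r} → WordLength x m → ProdOf r x → m ≤ r
  WordLength-minimal (inj₁ (_ , refl)) _ = z≤n
  WordLength-minimal (inj₂ (x≉ε , _ , _ , _)) ([] , refl , [] , ε≈x) = ⊥-elim (x≉ε (sym ε≈x))
  WordLength-minimal {m = m} {suc r} (inj₂ (_ , _ , _ , shorter)) x∈Aʳ with m ≤? suc r
  ... | yes m≤r = m≤r
  ... | no  m≰r = ⊥-elim (shorter (suc r) (s≤s z≤n) (≰⇒> m≰r) x∈Aʳ)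

  WordLength-prodOf : ∀ {x m} → WordLength x m → ProdOf m x
  WordLength-prodOf (inj₁ (x≈ε , refl)) = ProdOf-resp (sym x≈ε) ProdOf-ε
  WordLength-prodOf (inj₂ (_ , _ , x∈Aᵐ , _)) = x∈Aᵐ

  WordLength-intro : ∀ {x m} → ProdOf m x → (∀ {r} → ProdOf r x → m ≤ r) → WordLength x m
  WordLength-intro {m = zero} ([] , refl , [] , ε≈x) _ = inj₁ (sym ε≈x , refl)
  WordLength-intro {m = suc m} x∈Aᵐ minimal = inj₂
    ( (λ x≈ε → ⊥-elim (1+n≰n (≤-trans (minimal (ProdOf-resp (sym x≈ε) ProdOf-ε)) z≤n)))
    , s≤s z≤n , x∈Aᵐ , λ r _ r<m x∈Aʳ → <⇒≱ r<m (minimal x∈Aʳ))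

  WordLength-unique : ∀ {x m n} → WordLength x m → WordLength x n → m ≡ n
  WordLength-unique ℓx≡m ℓx≡n = ≤-antisym
    (WordLength-minimal ℓx≡m (WordLength-prodOf ℓx≡n))
    (WordLength-minimal ℓx≡n (WordLength-prodOf ℓx≡m))

  geodesic-cut : ∀ r s {x} → WordLength x (r + s) →
    ∃₂ λ p z → ProdOf r p × WordLength z s × x ≈ p ∙ z
  geodesic-cut r s ℓx≡r+s with ProdOf-split r s (WordLength-prodOf ℓx≡r+s)
  ... | p , z , p∈Aʳ , z∈Aˢ , x≈pz = p , z , p∈Aʳ , WordLength-intro z∈Aˢ z-minimal , x≈pz
    where
    z-minimal : ∀ {t} → ProdOf t z → s ≤ t
    z-minimal z∈Aᵗ = +-cancelˡ-≤ r s _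
      (WordLength-minimal ℓx≡r+s (ProdOf-resp (sym x≈pz) (ProdOf-∙ p∈Aʳ z∈Aᵗ)))

  cut-quotient : ∀ {x p z} → x ≈ p ∙ z → x ∙ z ⁻¹ ≈ p
  cut-quotient {p = p} {z} x≈pz = trans (∙-congʳ x≈pz) (//-rightDividesʳ z p)

  prolong-quotient : ∀ {x u y} → y ≈ u ∙ x → x ∙ y ⁻¹ ≈ u ⁻¹
  prolong-quotient {x} {u} y≈ux = trans (∙-congˡ (trans (⁻¹-cong y≈ux) (⁻¹-anti-homo-∙ u x)))
                                        (\\-leftDividesˡ x (u ⁻¹))

module Extension {c ℓ a : Level} (G : Group c ℓ) (A : Group.Carrier G → Set a)
  (extend : ∀ x → ∃ λ b → A b × ∃ λ m →
              WordMetric.WordLength G A x m × WordMetric.WordLength G A (Group._∙_ G b x) (suc m))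
  where
  open Group G hiding (refl)
  open WordMetric G A
  open WordFacts G A

  wordLength : ∀ x → ∃ λ n → WordLength x n
  wordLength x with extend x
  ... | _ , _ , n , ℓx≡n , _ = n , ℓx≡n

  prolong : ∀ k {x n} → WordLength x n →
    ∃₂ λ u y → ProdOf k u × y ≈ u ∙ x × WordLength y (n + k)
  prolong zero {x} {n} ℓx≡n =
    ε , x , ProdOf-ε , sym (identityˡ x) , ≡.subst (WordLength x) (≡.sym (+-identityʳ n)) ℓx≡n
  prolong (suc k) {x} {n} ℓx≡n with prolong k ℓx≡n
  ... | u , y , u∈Aᵏ , y≈ux , ℓy≡n+k with extend y
  ... | b , b∈A , m , ℓy≡m , ℓby≡1+m with WordLength-unique ℓy≡m ℓy≡n+k
  ... | refl = b ∙ u , b ∙ y , ProdOf-∙ (ProdOf-letter b∈A) u∈Aᵏ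
             , trans (∙-congˡ y≈ux) (sym (assoc b u x))
             , ≡.subst (WordLength (b ∙ y)) (≡.sym (+-suc n k)) ℓby≡1+m

  close : ∀ {h r x z} → r ≤ h → ProdOf r (x ∙ z ⁻¹) → ∃ λ m → m ≤ h × Dist x z m
  close {x = x} {z} r≤h xz⁻¹∈Aʳ with wordLength (x ∙ z ⁻¹)
  ... | m , ℓxz⁻¹≡m = m , ≤-trans (WordLength-minimal ℓxz⁻¹≡m xz⁻¹∈Aʳ) r≤h , ℓxz⁻¹≡m

  net : Symmetric → ∀ h → IsNet h (InC h)
  net symA h x with wordLength x
  ... | n , ℓx≡n with nearMultiple h n
  ... | inj₁ (q , r , r≤h , n≡r+Kq)
    with geodesic-cut r ((2 * h + 1) * q) (≡.subst (WordLength x) n≡r+Kq ℓx≡n)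
  ...   | p , z , p∈Aʳ , ℓz≡Kq , x≈pz =
    z , (q , ℓz≡Kq) , close r≤h (ProdOf-resp (sym (cut-quotient x≈pz)) p∈Aʳ)
  net symA h x | n , ℓx≡n | inj₂ (q , k , k≤h , n+k≡Kq)
    with prolong k ℓx≡n
  ...   | u , y , u∈Aᵏ , y≈ux , ℓy≡n+k =
    y , (q , ≡.subst (WordLength y) n+k≡Kq ℓy≡n+k)
      , close k≤h (ProdOf-resp (sym (prolong-quotient y≈ux)) (ProdOf-⁻¹ symA u∈Aᵏ))

-- Theorem: for every h, C = ⋃_q S_e((2h + 1) q) is an h-net in (G, d_A).

mainTheorem4 : {c ℓ a : Level} (G : Group c ℓ) (A : Group.Carrier G → Set a) →
    let open WordMetric G A in
    RespectsEq → Symmetric → Generating → A (Group.ε G) →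
    (∀ x → ∃ λ b → A b × ∃ λ m → WordLength x m × WordLength (Group._∙_ G b x) (suc m)) →
    ∀ (h : ℕ) → IsNet h (InC h)
mainTheorem4 G A _ symA _ _ extend = Extension.net G A extend symA
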